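{- Let $D=\{(a,a): a\in A(5)\}$ be the diagonal subgroup of $A(5)\times A(5)$, where $A(5)$ is the alternating group on 5 letters. Then for any subgroup $H$ of $A(5)\times A(5)$ of order $12$ or $36$, there is $a\in A(5)\times A(5)$ such that $|a^{ -1}Ha\cap D|\ne 3$. -}

module Defs where

open import Data.Nat using (ℕ; _%_)
open import Data.Fin using (Fin; zero; _<?_; _≟_)
open import Data.Fin.Properties using () renaming (_≟_ to _≟ᶠ_)
open import Data.Vec using (Vec; lookup; tabulate; toList; allFin)
open import Data.Vec.Properties using (≡-dec)
open import Data.List using (List; length; filter; concatMap; map; head)
open import Data.List.Relation.Unary.Unique.Propositional using (Unique)
open import Data.List.Relation.Unary.All using (All)
open import Data.List.Membership.Propositional using (_∈_)
open import Data.Maybe using (fromMaybe)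
open import Data.Product using (_×_; _,_; proj₁; proj₂)
open import Relation.Binary.PropositionalEquality using (_≡_)
open import Relation.Nullary using (Dec)

-- A map {0,..,4} → {0,..,4}, stored as its table of values σ(0),…,σ(4).
Perm5 : Set
Perm5 = Vec (Fin 5) 5

_·_ : Perm5 → Perm5 → Perm5
σ · τ = tabulate (λ i → lookup σ (lookup τ i))

idP : Perm5
idP = tabulate (λ i → i)

invP : Perm5 → Perm5
invP σ = tabulate (λ j → fromMaybe zero
           (head (filter (λ i → lookup σ i ≟ᶠ j) (toList (allFin 5)))))

IsPerm : Perm5 → Set
IsPerm σ = Unique (toList σ)

ordPairs : List (Fin 5 × Fin 5)
ordPairs = concatMap (λ i → map (λ j → (i , j))
             (filter (λ j → i <? j) (toList (allFin 5)))) (toList (allFin 5))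

inversions : Perm5 → ℕ
inversions σ = length (filter (λ p → lookup σ (proj₂ p) <? lookup σ (proj₁ p)) ordPairs)

InA5 : Perm5 → Set
InA5 σ = IsPerm σ × inversions σ % 2 ≡ 0

G : Set
G = Perm5 × Perm5

InG : G → Set
InG x = InA5 (proj₁ x) × InA5 (proj₂ x)

_*_ : G → G → G
(a , b) * (c , d) = (a · c , b · d)

e : G
e = (idP , idP)

inv : G → G
inv (a , b) = (invP a , invP b)

record IsSubgroup (H : List G) : Set where
  field
    unique   : Unique H
    inG      : All InG H
    hasId    : e ∈ H
    mulClosed : ∀ {x y} → x ∈ H → y ∈ H → (x * y) ∈ H
    invClosed : ∀ {x} → x ∈ H → inv x ∈ H

conj : G → G → G
conj a x = (inv a * x) * a

isDiag? : (x : G) → Dec (proj₁ x ≡ proj₂ x)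
isDiag? x = ≡-dec _≟ᶠ_ (proj₁ x) (proj₂ x)

conjMeetDiag : G → List G → ℕ
conjMeetDiag a H = length (filter isDiag? (map (conj a) H))

-- Write D_g = {(τ , g τ g⁻¹)} for the conjugate of the diagonal by (1 , g), so that
-- |(1 , g)⁻¹ H (1 , g) ∩ D| = |H ∩ D_g|.  Suppose |H ∩ D_g| = 3 for every g ∈ A(5).  Each H ∩ D_g is
-- closed under multiplication and the first projection is injective on it, so it projects onto a
-- subgroup of order 3 of A(5): the first coordinate of every h ≠ e of H lying in some D_g has order 3.
-- The centraliser of an element of order 3 in A(5) has order 3, so such an h lies in at most 3 of the
-- D_g, while e lies in all 60 of them.  Counting the pairs (g , h) with h ∈ H ∩ D_g in two ways gives
-- 3 · 60 ≤ 60 + 3 |H|, that is |H| ≥ 40.  The facts about the 60 elements of A(5) are decided by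
-- evaluation.

module Submission where

open import Defs renaming (_*_ to _*ᴳ_)
open import Data.Empty using (⊥-elim)
open import Data.Fin using (Fin; #_)
open import Data.Fin.Properties using () renaming (_≟_ to _≟ᶠ_; all? to allFin?)
open import Data.List using (List; []; _∷_; [_]; length; filter; map; concatMap; allFin)
open import Data.List.Membership.Propositional using (_∈_; find; lose)
open import Data.List.Membership.Propositional.Properties
  using (∈-filter⁺; ∈-filter⁻; ∈-map⁺; ∈-map⁻; ∈-allFin; ∈-concatMap⁺)
open import Data.List.Properties using (map-cong; length-filter; filter-none)
open import Data.List.Relation.Binary.Subset.Propositional using (_⊆_)
open import Data.List.Relation.Unary.All as All using (All; []; _∷_; all?)
open import Data.List.Relation.Unary.All.Properties using (¬All⇒Any¬; ¬Any⇒All¬)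
open import Data.List.Relation.Unary.AllPairs using ([]; _∷_)
open import Data.List.Relation.Unary.Any using (here; there; any?)
open import Data.List.Relation.Unary.Unique.Propositional using (Unique)
open import Data.List.Relation.Unary.Unique.Propositional.Properties
  using () renaming (filter⁺ to Unique-filter)
open import Data.List.Relation.Unary.Unique.DecPropositional (_≟ᶠ_ {5}) using (unique?)
open import Data.Nat as ℕ using (ℕ; zero; suc; _+_; _*_; _≤_; _≤?_; _<_; _<?_; z≤n)
open import Data.Nat.ListAction using (sum)
open import Data.Nat.Properties
  using (+-mono-≤; +-monoʳ-≤; *-monoʳ-≤; +-cancelˡ-≤; *-cancelˡ-≤; *-suc; *-zeroʳ; n≤1+n;
         ≤-trans; ≤-reflexive; <⇒≱; +-commutativeSemigroup; module ≤-Reasoning)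
open import Algebra.Properties.CommutativeSemigroup +-commutativeSemigroup using (interchange; x∙yz≈y∙xz)
open import Data.Product using (Σ; ∃-syntax; _×_; _,_; proj₁; proj₂)
open import Data.Product.Properties using () renaming (≡-dec to ×-≡-dec)
open import Data.Sum using (_⊎_; inj₁; inj₂)
open import Data.Vec using (Vec; []; _∷_; lookup; toList)
open import Data.Vec.Properties using (≡-dec; lookup∘tabulate; tabulate∘lookup; tabulate-cong)
open import Function using (_∘_)
open import Relation.Binary.Definitions using (DecidableEquality)
open import Relation.Binary.PropositionalEquality
  using (_≡_; _≢_; refl; sym; trans; cong; cong₂; subst; subst₂; ≢-sym; module ≡-Reasoning)
open import Relation.Nullary using (Dec; yes; no; ¬_; ¬?; _×-dec_)
open import Relation.Nullary.Decidable using (toWitness; _→-dec_)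
open import Relation.Unary using (Decidable)

private
  variable
    A B : Set

count : {P : A → Set} → Decidable P → List A → ℕ
count P? xs = length (filter P? xs)

indicator : {Q : Set} → Dec Q → ℕ
indicator (yes _) = 1
indicator (no _)  = 0

count-∷ : {P : A → Set} (P? : Decidable P) (x : A) (xs : List A) →
  count P? (x ∷ xs) ≡ indicator (P? x) + count P? xs
count-∷ P? x xs with P? x
... | yes _ = refl
... | no _  = refl

count≡sum-indicator : {P : A → Set} (P? : Decidable P) (xs : List A) →
  count P? xs ≡ sum (map (λ x → indicator (P? x)) xs)
count≡sum-indicator P? []       = refl
count≡sum-indicator P? (x ∷ xs) =
  trans (count-∷ P? x xs) (cong (_ +_) (count≡sum-indicator P? xs))

count-map : {P : A → Set} (P? : Decidable P) (f : B → A) (xs : List B) →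
  length (filter P? (map f xs)) ≡ count (P? ∘ f) xs
count-map P? f []       = refl
count-map P? f (x ∷ xs) with P? (f x)
... | yes _ = cong suc (count-map P? f xs)
... | no _  = count-map P? f xs

count-≤-by-witness : {P : A → Set} (P? : Decidable P) {xs : List A} {n : ℕ} →
  (∀ {x} → x ∈ xs → P x → count P? xs ≤ n) → count P? xs ≤ n
count-≤-by-witness P? {xs} bound with any? P? xs
... | yes ∃x = let _ , x∈xs , px = find ∃x in bound x∈xs px
... | no  ∄x = ≤-trans (≤-reflexive (cong length (filter-none P? (¬Any⇒All¬ xs ∄x)))) z≤n

sum-map-zero : (xs : List A) → sum (map (λ _ → 0) xs) ≡ 0
sum-map-zero []       = refl
sum-map-zero (x ∷ xs) = sum-map-zero xs

sum-map-+ : (f g : A → ℕ) (xs : List A) →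
  sum (map (λ x → f x + g x) xs) ≡ sum (map f xs) + sum (map g xs)
sum-map-+ f g []       = refl
sum-map-+ f g (x ∷ xs) =
  trans (cong (f x + g x +_) (sum-map-+ f g xs)) (interchange (f x) (g x) _ _)

sum-map-comm : (f : A → B → ℕ) (xs : List A) (ys : List B) →
  sum (map (λ x → sum (map (f x) ys)) xs) ≡ sum (map (λ y → sum (map (λ x → f x y) xs)) ys)
sum-map-comm f xs []       = sum-map-zero xs
sum-map-comm f xs (y ∷ ys) =
  trans (sum-map-+ (λ x → f x y) (λ x → sum (map (f x) ys)) xs) (cong (_ +_) (sum-map-comm f xs ys))

double-counting : {R : A → B → Set} (R? : ∀ x y → Dec (R x y)) (xs : List A) (ys : List B) →
  sum (map (λ x → count (R? x) ys) xs) ≡ sum (map (λ y → count (λ x → R? x y) xs) ys)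
double-counting R? xs ys = begin
  sum (map (λ x → count (R? x) ys) xs)
    ≡⟨ cong sum (map-cong (λ x → count≡sum-indicator (R? x) ys) xs) ⟩
  sum (map (λ x → sum (map (λ y → [R] x y) ys)) xs)
    ≡⟨ sum-map-comm [R] xs ys ⟩
  sum (map (λ y → sum (map (λ x → [R] x y) xs)) ys)
    ≡⟨ cong sum (map-cong (λ y → count≡sum-indicator (λ x → R? x y) xs) ys) ⟨
  sum (map (λ y → count (λ x → R? x y) xs) ys) ∎
  where
  open ≡-Reasoning
  [R] = λ x y → indicator (R? x y)

sum-map-const : (f : A → ℕ) {c : ℕ} {xs : List A} → All (λ x → f x ≡ c) xs →
  sum (map f xs) ≡ c * length xs
sum-map-const f {c} []                       = sym (*-zeroʳ c)
sum-map-const f {c} {_ ∷ xs} (fx≡c ∷ fxs≡c) =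
  trans (cong₂ _+_ fx≡c (sum-map-const f fxs≡c)) (sym (*-suc c (length xs)))

sum-map-≤-*length : (f : A → ℕ) {c : ℕ} {xs : List A} → (∀ {x} → x ∈ xs → f x ≤ c) →
  sum (map f xs) ≤ c * length xs
sum-map-≤-*length f {c} {[]}     _   = z≤n
sum-map-≤-*length f {c} {x ∷ xs} f≤c = ≤-trans
  (+-mono-≤ (f≤c (here refl)) (sum-map-≤-*length f (f≤c ∘ there)))
  (≤-reflexive (sym (*-suc c (length xs))))

sum-map-≤-except : DecidableEquality A → (f : A → ℕ) {y : A} {c d : ℕ} {xs : List A} → Unique xs →
  f y ≤ d → (∀ {x} → x ∈ xs → x ≢ y → f x ≤ c) → sum (map f xs) ≤ d + c * length xs
sum-map-≤-except _≟_ f {xs = []} _ _ _ = z≤n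
sum-map-≤-except _≟_ f {y} {c} {d} {x ∷ xs} (x∉xs ∷ xs!) fy≤d f≤c with x ≟ y
... | yes refl = begin
  f x + sum (map f xs)     ≤⟨ +-mono-≤ fy≤d (sum-map-≤-*length f λ x′∈xs →
                                f≤c (there x′∈xs) (≢-sym (All.lookup x∉xs x′∈xs))) ⟩
  d + c * length xs        ≤⟨ +-monoʳ-≤ d (*-monoʳ-≤ c (n≤1+n (length xs))) ⟩
  d + c * suc (length xs)  ∎
  where open ≤-Reasoning
... | no x≢y = begin
  f x + sum (map f xs)     ≤⟨ +-mono-≤ (f≤c (here refl) x≢y)
                                       (sum-map-≤-except _≟_ f xs! fy≤d (f≤c ∘ there)) ⟩
  c + (d + c * length xs)  ≡⟨ x∙yz≈y∙xz c d (c * length xs) ⟩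
  d + (c + c * length xs)  ≡⟨ cong (d +_) (*-suc c (length xs)) ⟨
  d + c * suc (length xs)  ∎
  where open ≤-Reasoning

⊆-triple : {x y z : A} {ys : List A} → x ∈ ys → y ∈ ys → z ∈ ys → x ∷ y ∷ z ∷ [] ⊆ ys
⊆-triple x∈ _  _  (here refl)                 = x∈
⊆-triple _  y∈ _  (there (here refl))         = y∈
⊆-triple _  _  z∈ (there (there (here refl))) = z∈

third-element : ∀ {A : Set} {a b : A} {xs : List A} →
  Unique xs → length xs ≡ 3 → a ∈ xs → b ∈ xs → a ≢ b →
  ∃[ c ] c ∈ xs × a ≢ c × b ≢ c × xs ⊆ a ∷ b ∷ c ∷ []
third-element {A} {xs = x ∷ y ∷ z ∷ []} ((x≢y ∷ x≢z ∷ []) ∷ (y≢z ∷ []) ∷ [] ∷ []) refl = pick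
  where
  p₀ : ∀ {u v w : A} → u ∈ u ∷ v ∷ w ∷ []
  p₀ = here refl
  p₁ : ∀ {u v w : A} → v ∈ u ∷ v ∷ w ∷ []
  p₁ = there (here refl)
  p₂ : ∀ {u v w : A} → w ∈ u ∷ v ∷ w ∷ []
  p₂ = there (there (here refl))
  pick : {a b : A} → a ∈ x ∷ y ∷ z ∷ [] → b ∈ x ∷ y ∷ z ∷ [] → a ≢ b →
         ∃[ c ] c ∈ x ∷ y ∷ z ∷ [] × a ≢ c × b ≢ c × x ∷ y ∷ z ∷ [] ⊆ a ∷ b ∷ c ∷ []
  pick (here refl) (there (here refl)) _ =
    z , p₂ , x≢z , y≢z , ⊆-triple p₀ p₁ p₂
  pick (here refl) (there (there (here refl))) _ =
    y , p₁ , x≢y , ≢-sym y≢z , ⊆-triple p₀ p₂ p₁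
  pick (there (here refl)) (here refl) _ =
    z , p₂ , y≢z , x≢z , ⊆-triple p₁ p₀ p₂
  pick (there (here refl)) (there (there (here refl))) _ =
    x , p₀ , ≢-sym x≢y , ≢-sym x≢z , ⊆-triple p₂ p₀ p₁
  pick (there (there (here refl))) (here refl) _ =
    y , p₁ , ≢-sym y≢z , x≢y , ⊆-triple p₁ p₂ p₀
  pick (there (there (here refl))) (there (here refl)) _ =
    x , p₀ , ≢-sym x≢z , ≢-sym x≢y , ⊆-triple p₂ p₁ p₀
  pick (here refl)                 (here refl)                 a≢a = ⊥-elim (a≢a refl)
  pick (there (here refl))         (there (here refl))         a≢a = ⊥-elim (a≢a refl)
  pick (there (there (here refl))) (there (there (here refl))) a≢a = ⊥-elim (a≢a refl)

vectors : List A → (n : ℕ) → List (Vec A n)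
vectors xs zero    = [ [] ]
vectors xs (suc n) = concatMap (λ x → map (x ∷_) (vectors xs n)) xs

∈-vectors : {xs : List A} → (∀ x → x ∈ xs) → ∀ {n} (v : Vec A n) → v ∈ vectors xs n
∈-vectors all∈ []      = here refl
∈-vectors all∈ (x ∷ v) = ∈-concatMap⁺ _ (lose (all∈ x) (∈-map⁺ (x ∷_) (∈-vectors all∈ v)))

_≟ₚ_ : DecidableEquality Perm5
_≟ₚ_ = ≡-dec _≟ᶠ_

_≟ᴳ_ : DecidableEquality G
_≟ᴳ_ = ×-≡-dec _≟ₚ_ _≟ₚ_

lookup-· : (σ τ : Perm5) (i : Fin 5) → lookup (σ · τ) i ≡ lookup σ (lookup τ i)
lookup-· σ τ = lookup∘tabulate (λ i → lookup σ (lookup τ i))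

lookup-idP : (i : Fin 5) → lookup idP i ≡ i
lookup-idP = lookup∘tabulate (λ i → i)

Perm5-ext : {σ τ : Perm5} → (∀ i → lookup σ i ≡ lookup τ i) → σ ≡ τ
Perm5-ext {σ} {τ} σ≗τ =
  trans (sym (tabulate∘lookup σ)) (trans (tabulate-cong σ≗τ) (tabulate∘lookup τ))

InA5? : (σ : Perm5) → Dec (InA5 σ)
InA5? σ = unique? (toList σ) ×-dec (inversions σ ℕ.% 2 ℕ.≟ 0)

-- Listed explicitly, and kept opaque outside the finite checks, because the decision procedures
-- below are too slow when A₅ has to be recomputed as the filter in A₅-enumerates.
opaque
  A₅ : List Perm5
  A₅ =
    (# 0 ∷ # 1 ∷ # 2 ∷ # 3 ∷ # 4 ∷ []) ∷ (# 0 ∷ # 1 ∷ # 3 ∷ # 4 ∷ # 2 ∷ []) ∷ (# 0 ∷ # 1 ∷ # 4 ∷ # 2 ∷ # 3 ∷ []) ∷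
    (# 0 ∷ # 2 ∷ # 1 ∷ # 4 ∷ # 3 ∷ []) ∷ (# 0 ∷ # 2 ∷ # 3 ∷ # 1 ∷ # 4 ∷ []) ∷ (# 0 ∷ # 2 ∷ # 4 ∷ # 3 ∷ # 1 ∷ []) ∷
    (# 0 ∷ # 3 ∷ # 1 ∷ # 2 ∷ # 4 ∷ []) ∷ (# 0 ∷ # 3 ∷ # 2 ∷ # 4 ∷ # 1 ∷ []) ∷ (# 0 ∷ # 3 ∷ # 4 ∷ # 1 ∷ # 2 ∷ []) ∷
    (# 0 ∷ # 4 ∷ # 1 ∷ # 3 ∷ # 2 ∷ []) ∷ (# 0 ∷ # 4 ∷ # 2 ∷ # 1 ∷ # 3 ∷ []) ∷ (# 0 ∷ # 4 ∷ # 3 ∷ # 2 ∷ # 1 ∷ []) ∷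
    (# 1 ∷ # 0 ∷ # 2 ∷ # 4 ∷ # 3 ∷ []) ∷ (# 1 ∷ # 0 ∷ # 3 ∷ # 2 ∷ # 4 ∷ []) ∷ (# 1 ∷ # 0 ∷ # 4 ∷ # 3 ∷ # 2 ∷ []) ∷
    (# 1 ∷ # 2 ∷ # 0 ∷ # 3 ∷ # 4 ∷ []) ∷ (# 1 ∷ # 2 ∷ # 3 ∷ # 4 ∷ # 0 ∷ []) ∷ (# 1 ∷ # 2 ∷ # 4 ∷ # 0 ∷ # 3 ∷ []) ∷
    (# 1 ∷ # 3 ∷ # 0 ∷ # 4 ∷ # 2 ∷ []) ∷ (# 1 ∷ # 3 ∷ # 2 ∷ # 0 ∷ # 4 ∷ []) ∷ (# 1 ∷ # 3 ∷ # 4 ∷ # 2 ∷ # 0 ∷ []) ∷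
    (# 1 ∷ # 4 ∷ # 0 ∷ # 2 ∷ # 3 ∷ []) ∷ (# 1 ∷ # 4 ∷ # 2 ∷ # 3 ∷ # 0 ∷ []) ∷ (# 1 ∷ # 4 ∷ # 3 ∷ # 0 ∷ # 2 ∷ []) ∷
    (# 2 ∷ # 0 ∷ # 1 ∷ # 3 ∷ # 4 ∷ []) ∷ (# 2 ∷ # 0 ∷ # 3 ∷ # 4 ∷ # 1 ∷ []) ∷ (# 2 ∷ # 0 ∷ # 4 ∷ # 1 ∷ # 3 ∷ []) ∷
    (# 2 ∷ # 1 ∷ # 0 ∷ # 4 ∷ # 3 ∷ []) ∷ (# 2 ∷ # 1 ∷ # 3 ∷ # 0 ∷ # 4 ∷ []) ∷ (# 2 ∷ # 1 ∷ # 4 ∷ # 3 ∷ # 0 ∷ []) ∷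
    (# 2 ∷ # 3 ∷ # 0 ∷ # 1 ∷ # 4 ∷ []) ∷ (# 2 ∷ # 3 ∷ # 1 ∷ # 4 ∷ # 0 ∷ []) ∷ (# 2 ∷ # 3 ∷ # 4 ∷ # 0 ∷ # 1 ∷ []) ∷
    (# 2 ∷ # 4 ∷ # 0 ∷ # 3 ∷ # 1 ∷ []) ∷ (# 2 ∷ # 4 ∷ # 1 ∷ # 0 ∷ # 3 ∷ []) ∷ (# 2 ∷ # 4 ∷ # 3 ∷ # 1 ∷ # 0 ∷ []) ∷
    (# 3 ∷ # 0 ∷ # 1 ∷ # 4 ∷ # 2 ∷ []) ∷ (# 3 ∷ # 0 ∷ # 2 ∷ # 1 ∷ # 4 ∷ []) ∷ (# 3 ∷ # 0 ∷ # 4 ∷ # 2 ∷ # 1 ∷ []) ∷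
    (# 3 ∷ # 1 ∷ # 0 ∷ # 2 ∷ # 4 ∷ []) ∷ (# 3 ∷ # 1 ∷ # 2 ∷ # 4 ∷ # 0 ∷ []) ∷ (# 3 ∷ # 1 ∷ # 4 ∷ # 0 ∷ # 2 ∷ []) ∷
    (# 3 ∷ # 2 ∷ # 0 ∷ # 4 ∷ # 1 ∷ []) ∷ (# 3 ∷ # 2 ∷ # 1 ∷ # 0 ∷ # 4 ∷ []) ∷ (# 3 ∷ # 2 ∷ # 4 ∷ # 1 ∷ # 0 ∷ []) ∷
    (# 3 ∷ # 4 ∷ # 0 ∷ # 1 ∷ # 2 ∷ []) ∷ (# 3 ∷ # 4 ∷ # 1 ∷ # 2 ∷ # 0 ∷ []) ∷ (# 3 ∷ # 4 ∷ # 2 ∷ # 0 ∷ # 1 ∷ []) ∷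
    (# 4 ∷ # 0 ∷ # 1 ∷ # 2 ∷ # 3 ∷ []) ∷ (# 4 ∷ # 0 ∷ # 2 ∷ # 3 ∷ # 1 ∷ []) ∷ (# 4 ∷ # 0 ∷ # 3 ∷ # 1 ∷ # 2 ∷ []) ∷
    (# 4 ∷ # 1 ∷ # 0 ∷ # 3 ∷ # 2 ∷ []) ∷ (# 4 ∷ # 1 ∷ # 2 ∷ # 0 ∷ # 3 ∷ []) ∷ (# 4 ∷ # 1 ∷ # 3 ∷ # 2 ∷ # 0 ∷ []) ∷
    (# 4 ∷ # 2 ∷ # 0 ∷ # 1 ∷ # 3 ∷ []) ∷ (# 4 ∷ # 2 ∷ # 1 ∷ # 3 ∷ # 0 ∷ []) ∷ (# 4 ∷ # 2 ∷ # 3 ∷ # 0 ∷ # 1 ∷ []) ∷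
    (# 4 ∷ # 3 ∷ # 0 ∷ # 2 ∷ # 1 ∷ []) ∷ (# 4 ∷ # 3 ∷ # 1 ∷ # 0 ∷ # 2 ∷ []) ∷ (# 4 ∷ # 3 ∷ # 2 ∷ # 1 ∷ # 0 ∷ []) ∷
    []

cube : Perm5 → Perm5
cube τ = τ · (τ · τ)

ConjInDiag : Perm5 → G → Set
ConjInDiag g x = proj₁ (conj (idP , g) x) ≡ proj₂ (conj (idP , g) x)

conjInDiag? : (g : Perm5) → Decidable (ConjInDiag g)
conjInDiag? g x = isDiag? (conj (idP , g) x)

conjugatorCount : G → ℕ
conjugatorCount x = count (λ g → conjInDiag? g x) A₅

opaque
  unfolding A₅

  A₅-enumerates : A₅ ≡ filter InA5? (vectors (allFin 5) 5)
  A₅-enumerates = refl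

  length-A₅ : length A₅ ≡ 60
  length-A₅ = refl

  invP-inverseʳ-on-A₅ : All (λ g → ∀ j → lookup g (lookup (invP g) j) ≡ j) A₅
  invP-inverseʳ-on-A₅ = toWitness
    {a? = all? (λ g → allFin? (λ j → lookup g (lookup (invP g) j) ≟ᶠ j)) A₅} _

  invP-inverseˡ-on-A₅ : All (λ g → ∀ i → lookup (invP g) (lookup g i) ≡ i) A₅
  invP-inverseˡ-on-A₅ = toWitness
    {a? = all? (λ g → allFin? (λ i → lookup (invP g) (lookup g i) ≟ᶠ i)) A₅} _

  closed-triple-order3-on-A₅ : All (λ τ → All (λ ρ → τ ≢ idP → ρ ≢ idP → τ ≢ ρ →
    All (λ u → All (λ v → u · v ∈ idP ∷ τ ∷ ρ ∷ []) (idP ∷ τ ∷ ρ ∷ [])) (idP ∷ τ ∷ ρ ∷ []) →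
    cube τ ≡ idP) A₅) A₅
  closed-triple-order3-on-A₅ = toWitness {a? = all? (λ τ → all? (λ ρ →
    ¬? (τ ≟ₚ idP) →-dec ¬? (ρ ≟ₚ idP) →-dec ¬? (τ ≟ₚ ρ) →-dec
    all? (λ u → all? (λ v → any? ((u · v) ≟ₚ_) (idP ∷ τ ∷ ρ ∷ [])) (idP ∷ τ ∷ ρ ∷ [])) (idP ∷ τ ∷ ρ ∷ []) →-dec
    cube τ ≟ₚ idP) A₅) A₅} _

  conjugatorCount≤3-of-order3-on-A₅ : All (λ τ → All (λ σ → τ ≢ idP → cube τ ≡ idP →
    conjugatorCount (τ , σ) ≤ 3) A₅) A₅
  conjugatorCount≤3-of-order3-on-A₅ = toWitness {a? = all? (λ τ → all? (λ σ →
    ¬? (τ ≟ₚ idP) →-dec (cube τ ≟ₚ idP) →-dec (conjugatorCount (τ , σ) ≤? 3)) A₅) A₅} _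

∈A₅⇒InA5 : {σ : Perm5} → σ ∈ A₅ → InA5 σ
∈A₅⇒InA5 {σ} σ∈A₅ =
  proj₂ (∈-filter⁻ InA5? {xs = vectors (allFin 5) 5} (subst (σ ∈_) A₅-enumerates σ∈A₅))

InA5⇒∈A₅ : {σ : Perm5} → InA5 σ → σ ∈ A₅
InA5⇒∈A₅ {σ} σ-even =
  subst (σ ∈_) (sym A₅-enumerates) (∈-filter⁺ InA5? (∈-vectors ∈-allFin σ) σ-even)

idP-even : InA5 idP
idP-even = toWitness {a? = InA5? idP} _

lookup-conj : (σ τ : Perm5) (i : Fin 5) →
  lookup ((invP σ · τ) · σ) i ≡ lookup (invP σ) (lookup τ (lookup σ i))
lookup-conj σ τ i = trans (lookup-· (invP σ · τ) σ i) (lookup-· (invP σ) τ (lookup σ i))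

lookup-conj-idP : (τ : Perm5) (i : Fin 5) → lookup ((invP idP · τ) · idP) i ≡ lookup τ i
lookup-conj-idP τ i =
  trans (lookup-conj idP τ i) (trans (lookup-idP _) (cong (lookup τ) (lookup-idP i)))

-- x ∈ D_g, i.e. x₂ = g x₁ g⁻¹, stated as x₂ ∘ g = g ∘ x₁ so that no inverse is involved.
InTwistedDiag : Perm5 → G → Set
InTwistedDiag g x = ∀ i → lookup (proj₂ x) (lookup g i) ≡ lookup g (lookup (proj₁ x) i)

inTwistedDiag-e : {g : Perm5} → InTwistedDiag g e
inTwistedDiag-e {g} i = trans (lookup-idP (lookup g i)) (cong (lookup g) (sym (lookup-idP i)))

inTwistedDiag-*ᴳ : {g : Perm5} {x y : G} →
  InTwistedDiag g x → InTwistedDiag g y → InTwistedDiag g (x *ᴳ y)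
inTwistedDiag-*ᴳ {g} {x₁ , x₂} {y₁ , y₂} gx gy i = begin
  lookup (x₂ · y₂) (lookup g i)      ≡⟨ lookup-· x₂ y₂ (lookup g i) ⟩
  lookup x₂ (lookup y₂ (lookup g i)) ≡⟨ cong (lookup x₂) (gy i) ⟩
  lookup x₂ (lookup g (lookup y₁ i)) ≡⟨ gx (lookup y₁ i) ⟩
  lookup g (lookup x₁ (lookup y₁ i)) ≡⟨ cong (lookup g) (lookup-· x₁ y₁ i) ⟨
  lookup g (lookup (x₁ · y₁) i)      ∎
  where open ≡-Reasoning

module _ {g : Perm5} (g∈A₅ : g ∈ A₅) where

  private
    g∘g⁻¹ : ∀ j → lookup g (lookup (invP g) j) ≡ j
    g∘g⁻¹ = All.lookup invP-inverseʳ-on-A₅ g∈A₅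

    g⁻¹∘g : ∀ i → lookup (invP g) (lookup g i) ≡ i
    g⁻¹∘g = All.lookup invP-inverseˡ-on-A₅ g∈A₅

  conjInDiag⇒inTwistedDiag : {x : G} → ConjInDiag g x → InTwistedDiag g x
  conjInDiag⇒inTwistedDiag {x₁ , x₂} x∈D i = begin
    lookup x₂ (lookup g i)                              ≡⟨ g∘g⁻¹ _ ⟨
    lookup g (lookup (invP g) (lookup x₂ (lookup g i))) ≡⟨ cong (lookup g) (lookup-conj g x₂ i) ⟨
    lookup g (lookup ((invP g · x₂) · g) i)             ≡⟨ cong (λ σ → lookup g (lookup σ i)) x∈D ⟨
    lookup g (lookup ((invP idP · x₁) · idP) i)         ≡⟨ cong (lookup g) (lookup-conj-idP x₁ i) ⟩
    lookup g (lookup x₁ i)                              ∎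
    where open ≡-Reasoning

  inTwistedDiag⇒conjInDiag : {x : G} → InTwistedDiag g x → ConjInDiag g x
  inTwistedDiag⇒conjInDiag {x₁ , x₂} gx = Perm5-ext λ i → begin
    lookup ((invP idP · x₁) · idP) i         ≡⟨ lookup-conj-idP x₁ i ⟩
    lookup x₁ i                              ≡⟨ g⁻¹∘g _ ⟨
    lookup (invP g) (lookup g (lookup x₁ i)) ≡⟨ cong (lookup (invP g)) (gx i) ⟨
    lookup (invP g) (lookup x₂ (lookup g i)) ≡⟨ lookup-conj g x₂ i ⟨
    lookup ((invP g · x₂) · g) i             ∎
    where open ≡-Reasoning

  inTwistedDiag-proj₁-injective : {x y : G} →
    InTwistedDiag g x → InTwistedDiag g y → proj₁ x ≡ proj₁ y → x ≡ y
  inTwistedDiag-proj₁-injective {x₁ , x₂} {y₁ , y₂} gx gy refl = cong (x₁ ,_) (Perm5-ext λ j →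
    let i = lookup (invP g) j in begin
    lookup x₂ j            ≡⟨ cong (lookup x₂) (g∘g⁻¹ j) ⟨
    lookup x₂ (lookup g i) ≡⟨ gx i ⟩
    lookup g (lookup x₁ i) ≡⟨ gy i ⟨
    lookup y₂ (lookup g i) ≡⟨ cong (lookup y₂) (g∘g⁻¹ j) ⟩
    lookup y₂ j            ∎)
    where open ≡-Reasoning

Closed : List Perm5 → Set
Closed T = ∀ {u v} → u ∈ T → v ∈ T → u · v ∈ T

order3-in-closed-triple : {τ ρ : Perm5} → τ ∈ A₅ → ρ ∈ A₅ → τ ≢ idP → ρ ≢ idP → τ ≢ ρ →
  Closed (idP ∷ τ ∷ ρ ∷ []) → cube τ ≡ idP
order3-in-closed-triple τ∈A₅ ρ∈A₅ τ≢idP ρ≢idP τ≢ρ closed =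
  All.lookup (All.lookup closed-triple-order3-on-A₅ τ∈A₅) ρ∈A₅ τ≢idP ρ≢idP τ≢ρ
    (All.tabulate λ u∈ → All.tabulate λ v∈ → closed u∈ v∈)

conjugatorCount≤3-of-order3 : {τ σ : Perm5} → τ ∈ A₅ → σ ∈ A₅ → τ ≢ idP → cube τ ≡ idP →
  conjugatorCount (τ , σ) ≤ 3
conjugatorCount≤3-of-order3 τ∈A₅ σ∈A₅ =
  All.lookup (All.lookup conjugatorCount≤3-of-order3-on-A₅ τ∈A₅) σ∈A₅

MeetsEveryTwistedDiagIn3 : List G → Set
MeetsEveryTwistedDiagIn3 H = All (λ g → count (conjInDiag? g) H ≡ 3) A₅

module _ {H : List G} (H≤ : IsSubgroup H) where

  open IsSubgroup H≤

  proj₁∈A₅ : {x : G} → x ∈ H → proj₁ x ∈ A₅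
  proj₁∈A₅ x∈H = InA5⇒∈A₅ (proj₁ (All.lookup inG x∈H))

  proj₂∈A₅ : {x : G} → x ∈ H → proj₂ x ∈ A₅
  proj₂∈A₅ x∈H = InA5⇒∈A₅ (proj₂ (All.lookup inG x∈H))

  module _ {g : Perm5} (g∈A₅ : g ∈ A₅) where

    H∩D : List G
    H∩D = filter (conjInDiag? g) H

    H∩D⊆H : H∩D ⊆ H
    H∩D⊆H x∈H∩D = proj₁ (∈-filter⁻ (conjInDiag? g) {xs = H} x∈H∩D)

    ∈H∩D⇒inTwistedDiag : {x : G} → x ∈ H∩D → InTwistedDiag g x
    ∈H∩D⇒inTwistedDiag {x} x∈H∩D =
      conjInDiag⇒inTwistedDiag g∈A₅ {x} (proj₂ (∈-filter⁻ (conjInDiag? g) {xs = H} x∈H∩D))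

    inTwistedDiag⇒∈H∩D : {x : G} → x ∈ H → InTwistedDiag g x → x ∈ H∩D
    inTwistedDiag⇒∈H∩D {x} x∈H gx =
      ∈-filter⁺ (conjInDiag? g) x∈H (inTwistedDiag⇒conjInDiag g∈A₅ {x} gx)

    e∈H∩D : e ∈ H∩D
    e∈H∩D = inTwistedDiag⇒∈H∩D hasId (inTwistedDiag-e {g})

    H∩D-*-closed : {x y : G} → x ∈ H∩D → y ∈ H∩D → x *ᴳ y ∈ H∩D
    H∩D-*-closed {x} {y} x∈ y∈ = inTwistedDiag⇒∈H∩D (mulClosed (H∩D⊆H x∈) (H∩D⊆H y∈))
      (inTwistedDiag-*ᴳ {g} {x} {y} (∈H∩D⇒inTwistedDiag x∈) (∈H∩D⇒inTwistedDiag y∈))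

    H∩D-proj₁-≢ : {x y : G} → x ∈ H∩D → y ∈ H∩D → x ≢ y → proj₁ x ≢ proj₁ y
    H∩D-proj₁-≢ {x} {y} x∈ y∈ x≢y = x≢y ∘
      inTwistedDiag-proj₁-injective g∈A₅ {x} {y} (∈H∩D⇒inTwistedDiag x∈) (∈H∩D⇒inTwistedDiag y∈)

    map-proj₁-closed : {T : List G} → T ⊆ H∩D → H∩D ⊆ T → Closed (map proj₁ T)
    map-proj₁-closed {T} T⊆H∩D H∩D⊆T u∈ v∈ =
      let x , x∈T , u≡x₁ = ∈-map⁻ proj₁ {xs = T} u∈
          y , y∈T , v≡y₁ = ∈-map⁻ proj₁ {xs = T} v∈
      in subst₂ (λ u v → u · v ∈ map proj₁ T) (sym u≡x₁) (sym v≡y₁)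
           (∈-map⁺ proj₁ (H∩D⊆T (H∩D-*-closed (T⊆H∩D x∈T) (T⊆H∩D y∈T))))

    order3-in-triple-intersection : length H∩D ≡ 3 → {h : G} → h ∈ H∩D → h ≢ e →
      proj₁ h ≢ idP × cube (proj₁ h) ≡ idP
    order3-in-triple-intersection |H∩D|≡3 {h} h∈ h≢e =
      from-third (third-element (Unique-filter (conjInDiag? g) unique) |H∩D|≡3 e∈H∩D h∈ (≢-sym h≢e))
      where
      from-third : ∃[ k ] k ∈ H∩D × e ≢ k × h ≢ k × H∩D ⊆ e ∷ h ∷ k ∷ [] →
        proj₁ h ≢ idP × cube (proj₁ h) ≡ idP
      from-third (k , k∈ , e≢k , h≢k , H∩D⊆T) =
        H∩D-proj₁-≢ h∈ e∈H∩D h≢e ,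
        order3-in-closed-triple (proj₁∈A₅ (H∩D⊆H h∈)) (proj₁∈A₅ (H∩D⊆H k∈))
          (H∩D-proj₁-≢ h∈ e∈H∩D h≢e) (H∩D-proj₁-≢ k∈ e∈H∩D (≢-sym e≢k)) (H∩D-proj₁-≢ h∈ k∈ h≢k)
          (map-proj₁-closed (⊆-triple e∈H∩D h∈ k∈) H∩D⊆T)

  conjugatorCount≤3 : MeetsEveryTwistedDiagIn3 H → {h : G} → h ∈ H → h ≢ e → conjugatorCount h ≤ 3
  conjugatorCount≤3 meets3 {h} h∈H h≢e =
    count-≤-by-witness (λ g → conjInDiag? g h) λ {g} g∈A₅ h∈D →
      let h₁≢idP , h₁-order3 = order3-in-triple-intersection g∈A₅ (All.lookup meets3 g∈A₅)
                                 (∈-filter⁺ (conjInDiag? g) h∈H h∈D) h≢e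
      in conjugatorCount≤3-of-order3 (proj₁∈A₅ h∈H) (proj₂∈A₅ h∈H) h₁≢idP h₁-order3

  meetsEveryTwistedDiagIn3⇒40≤order : MeetsEveryTwistedDiagIn3 H → 40 ≤ length H
  meetsEveryTwistedDiagIn3⇒40≤order meets3 =
    *-cancelˡ-≤ 3 (+-cancelˡ-≤ 60 (3 * 40) (3 * length H)
      (subst (λ m → 3 * m ≤ m + 3 * length H) length-A₅ (begin
        3 * length A₅                                ≡⟨ sum-map-const (λ g → count (conjInDiag? g) H) meets3 ⟨
        sum (map (λ g → count (conjInDiag? g) H) A₅) ≡⟨ double-counting conjInDiag? A₅ H ⟩
        sum (map conjugatorCount H)                  ≤⟨ sum-map-≤-except _≟ᴳ_ conjugatorCount unique
                                                          (length-filter (λ g → conjInDiag? g e) A₅)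
                                                          (conjugatorCount≤3 meets3) ⟩
        length A₅ + 3 * length H                     ∎)))
    where open ≤-Reasoning

conjMeetDiag≡count : (g : Perm5) (H : List G) → conjMeetDiag (idP , g) H ≡ count (conjInDiag? g) H
conjMeetDiag≡count g H = count-map isDiag? (conj (idP , g)) H

12∨36<40 : {n : ℕ} → n ≡ 12 ⊎ n ≡ 36 → n < 40
12∨36<40 (inj₁ refl) = toWitness {a? = 12 <? 40} _
12∨36<40 (inj₂ refl) = toWitness {a? = 36 <? 40} _

lemma3p4 : (H : List G) → IsSubgroup H → (length H ≡ 12 ⊎ length H ≡ 36) →
    Σ G (λ a → InG a × conjMeetDiag a H ≢ 3)
lemma3p4 H H≤ |H|≡12∨36 =
  conjugate-by (find (¬All⇒Any¬ (λ g → count (conjInDiag? g) H ℕ.≟ 3) A₅ ¬meets3))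
  where
  ¬meets3 : ¬ MeetsEveryTwistedDiagIn3 H
  ¬meets3 meets3 = <⇒≱ (12∨36<40 |H|≡12∨36) (meetsEveryTwistedDiagIn3⇒40≤order H≤ meets3)
  conjugate-by : ∃[ g ] g ∈ A₅ × count (conjInDiag? g) H ≢ 3 →
    Σ G (λ a → InG a × conjMeetDiag a H ≢ 3)
  conjugate-by (g , g∈A₅ , ≢3) =
    (idP , g) , (idP-even , ∈A₅⇒InA5 g∈A₅) , ≢3 ∘ trans (sym (conjMeetDiag≡count g H))
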